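{- For all closed closures $(t,e)$ and $(s,d)$: $(t,e)\approx_{\mathrm{app}}(s,d)$ if and only if $\langle t,e,[\,]\rangle_{\mathsf{ev}}\approx_{\mathrm m}\langle s,d,[\,]\rangle_{\mathsf{ev}}$, where $\approx_{\mathrm m}$ is machine bisimilarity for the AB machine.
   Context: De Bruijn terms $t,s ::= n\mid t\,s\mid\lambda.t$ ($n\in\mathbb N$); $t$ is closed if every index $n$ occurs under at least $n+1$ enclosing $\lambda$'s. Closures $\sigma ::= (t,e)$, environments $e,d ::= \sigma::e\mid\epsilon$, stacks $\pi ::= \sigma::\pi\mid[\,]$. A closure $(t,e)$ is closed if the number of elements of $e$ exceeds the highest free index of $t$ and $e$ consists only of closed closures. Application stacks $\rho ::= (t,k)::\rho\mid[\,]_\rho$, $k\in\mathbb N$. AB machine: configurations $\langle t,e,\pi\rangle_{\mathsf{ev}}$, $\langle n,\rho,\sigma\rangle_{\mathsf{ind}}$, $\langle t,k,\rho,\sigma\rangle_{\mathsf{tm}}$. Transitions: $\langle t\,s,e,\pi\rangle_{\mathsf{ev}}\xrightarrow{\tau}\langle t,e,(s,e)::\pi\rangle_{\mathsf{ev}}$; $\langle 0,(t,e)::d,\pi\rangle_{\mathsf{ev}}\xrightarrow{\tau}\langle t,e,\pi\rangle_{\mathsf{ev}}$; $\langle n+1,(t,e)::d,\pi\rangle_{\mathsf{ev}}\xrightarrow{\tau}\langle n,d,\pi\rangle_{\mathsf{ev}}$; $\langle\lambda.t,e,\sigma::\pi\rangle_{\mathsf{ev}}\xrightarrow{\tau}\langle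 t,\sigma::e,\pi\rangle_{\mathsf{ev}}$; $\langle\lambda.t,e,[\,]\rangle_{\mathsf{ev}}\xrightarrow{\mathsf{arg}}\langle 0,[\,]_\rho,(t,e)\rangle_{\mathsf{ind}}$; $\langle n,\rho,\sigma\rangle_{\mathsf{ind}}\xrightarrow{\mathsf{suc}}\langle n+1,\rho,\sigma\rangle_{\mathsf{ind}}$; $\langle n,\rho,\sigma\rangle_{\mathsf{ind}}\xrightarrow{\mathsf{var}}\langle n,n+1,\rho,\sigma\rangle_{\mathsf{tm}}$; $\langle t,k+1,\rho,\sigma\rangle_{\mathsf{tm}}\xrightarrow{\mathsf{lam}}\langle\lambda.t,k,\rho,\sigma\rangle_{\mathsf{tm}}$; $\langle t,0,\rho,\sigma\rangle_{\mathsf{tm}}\xrightarrow{\mathsf{lam}}\langle\lambda.t,0,\rho,\sigma\rangle_{\mathsf{tm}}$; $\langle t,k,\rho,\sigma\rangle_{\mathsf{tm}}\xrightarrow{\mathsf{appfun}}\langle 0,(t,k)::\rho,\sigma\rangle_{\mathsf{ind}}$; $\langle s,k_1,(t,k_2)::\rho,\sigma\rangle_{\mathsf{tm}}\xrightarrow{\mathsf{app}}\langle t\,s,\max(k_1,k_2),\rho,\sigma\rangle_{\mathsf{tm}}$; $\langle t,0,[\,]_\rho,(s,e)\rangle_{\mathsf{tm}}\xrightarrow{\mathsf{done}}\langle s,(t,\epsilon)::e,[\,]\rangle_{\mathsf{ev}}$. The $\tau$-transitions alone form the (environment-based) KAM. Applicative bisimilarity: a symmetric relation $\mathcal R$ on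 closed closures is an applicative bisimulation if $(t,e)\mathcal R(s,d)$ and $\langle t,e,[\,]\rangle_{\mathsf{ev}}\xrightarrow{\tau}^*\langle\lambda.t',e',[\,]\rangle_{\mathsf{ev}}$ imply that there are $s',d'$ with $\langle s,d,[\,]\rangle_{\mathsf{ev}}\xrightarrow{\tau}^*\langle\lambda.s',d',[\,]\rangle_{\mathsf{ev}}$ and, for every closed term $t''$, $(t',(t'',\epsilon)::e')\,\mathcal R\,(s',(t'',\epsilon)::d')$. $\approx_{\mathrm{app}}$ is the largest applicative bisimulation. Machine bisimilarity: with $F$ ranging over flags (non-$\tau$ labels), a symmetric $\mathcal R$ on configurations is a machine bisimulation if $C_1\mathcal R C_2$ implies: if $C_1\xrightarrow{\tau}^*\xrightarrow{F}C_1'$ then $C_2\xrightarrow{\tau}^*\xrightarrow{F}C_2'$ for some $C_2'$ with $C_1'\mathcal R C_2'$; and if $C_1\xrightarrow{\tau}^*\xrightarrow{F}$ by a terminating transition then so does $C_2$. $\approx_{\mathrm m}$ is the largest one. -}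

module Defs where

open import Data.Nat using (ℕ; zero; suc; _<_; _⊔_)
open import Data.List using (List; []; _∷_; length)
open import Data.List.Relation.Unary.All using (All)
open import Data.Product using (Σ; Σ-syntax; _×_; _,_)
open import Relation.Binary.Construct.Closure.ReflexiveTransitive using (Star)

data Tm : Set where
  var : ℕ → Tm
  app : Tm → Tm → Tm
  lam : Tm → Tm

data WS : ℕ → Tm → Set where
  var : ∀ {m n} → n < m → WS m (var n)
  app : ∀ {m t s} → WS m t → WS m s → WS m (app t s)
  lam : ∀ {m t} → WS (suc m) t → WS m (lam t)

ClosedTm : Tm → Set
ClosedTm = WS 0

data Clo : Set where
  clo : Tm → List Clo → Clo

Env : Set
Env = List Clo

Stack : Set
Stack = List Clo

data ClosedClo : Clo → Set where
  clo : ∀ {t e} → WS (length e) t → All ClosedClo e → ClosedClo (clo t e)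

AppStack : Set
AppStack = List (Tm × ℕ)

data Conf : Set where
  ev  : Tm → Env → Stack → Conf
  ind : ℕ → AppStack → Clo → Conf
  tm  : Tm → ℕ → AppStack → Clo → Conf

data Flag : Set where
  arg suc var lam appfun app done : Flag

data Label : Set where
  τ : Label
  fl : Flag → Label

data _⟶[_]_ : Conf → Label → Conf → Set where
  ev-app  : ∀ {t s e π} → ev (app t s) e π ⟶[ τ ] ev t e (clo s e ∷ π)
  ev-zero : ∀ {t e d π} → ev (var 0) (clo t e ∷ d) π ⟶[ τ ] ev t e π
  ev-suc  : ∀ {n t e d π} → ev (var (suc n)) (clo t e ∷ d) π ⟶[ τ ] ev (var n) d π
  ev-lam  : ∀ {t e σ π} → ev (lam t) e (σ ∷ π) ⟶[ τ ] ev t (σ ∷ e) π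
  ev-arg  : ∀ {t e} → ev (lam t) e [] ⟶[ fl arg ] ind 0 [] (clo t e)
  ind-suc : ∀ {n ρ σ} → ind n ρ σ ⟶[ fl suc ] ind (suc n) ρ σ
  ind-var : ∀ {n ρ σ} → ind n ρ σ ⟶[ fl var ] tm (var n) (suc n) ρ σ
  tm-lam-suc : ∀ {t k ρ σ} → tm t (suc k) ρ σ ⟶[ fl lam ] tm (lam t) k ρ σ
  tm-lam-zero : ∀ {t ρ σ} → tm t 0 ρ σ ⟶[ fl lam ] tm (lam t) 0 ρ σ
  tm-appfun : ∀ {t k ρ σ} → tm t k ρ σ ⟶[ fl appfun ] ind 0 ((t , k) ∷ ρ) σ
  tm-app  : ∀ {s k₁ t k₂ ρ σ} → tm s k₁ ((t , k₂) ∷ ρ) σ ⟶[ fl app ] tm (app t s) (k₁ ⊔ k₂) ρ σ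
  tm-done : ∀ {t s e} → tm t 0 [] (clo s e) ⟶[ fl done ] ev s (clo t [] ∷ e) []

-- terminating (target-less) flagged transitions: the AB machine has none
data _⟶[_]end : Conf → Flag → Set where

_⟶τ_ : Conf → Conf → Set
C ⟶τ C' = C ⟶[ τ ] C'

_⟶τ*_ : Conf → Conf → Set
_⟶τ*_ = Star _⟶τ_

_⟹[_]_ : Conf → Flag → Conf → Set
C ⟹[ F ] C' = Σ[ C₀ ∈ Conf ] (C ⟶τ* C₀ × C₀ ⟶[ fl F ] C')

_⟹[_]end : Conf → Flag → Set
C ⟹[ F ]end = Σ[ C₀ ∈ Conf ] (C ⟶τ* C₀ × C₀ ⟶[ F ]end)

record AppBisim (R : Clo → Clo → Set) : Set where
  field
    closed : ∀ {x y} → R x y → ClosedClo x × ClosedClo y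
    sym    : ∀ {x y} → R x y → R y x
    step   : ∀ {t e s d t' e'} → R (clo t e) (clo s d) →
             ev t e [] ⟶τ* ev (lam t') e' [] →
             Σ[ s' ∈ Tm ] Σ[ d' ∈ Env ]
               (ev s d [] ⟶τ* ev (lam s') d' [] ×
                (∀ t'' → ClosedTm t'' →
                   R (clo t' (clo t'' [] ∷ e')) (clo s' (clo t'' [] ∷ d'))))

_≈app_ : Clo → Clo → Set₁
x ≈app y = Σ[ R ∈ (Clo → Clo → Set) ] (AppBisim R × R x y)

record MachBisim (R : Conf → Conf → Set) : Set where
  field
    sym  : ∀ {C₁ C₂} → R C₁ C₂ → R C₂ C₁
    step : ∀ {C₁ C₂ F C₁'} → R C₁ C₂ → C₁ ⟹[ F ] C₁' →
           Σ[ C₂' ∈ Conf ] (C₂ ⟹[ F ] C₂' × R C₁' C₂')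
    term : ∀ {C₁ C₂ F} → R C₁ C₂ → C₁ ⟹[ F ]end → C₂ ⟹[ F ]end

_≈m_ : Conf → Conf → Set₁
C₁ ≈m C₂ = Σ[ R ∈ (Conf → Conf → Set) ] (MachBisim R × R C₁ C₂)

{-# OPTIONS --safe #-}
-- The AB machine extends the KAM so that, once evaluation reaches a lambda
-- with an empty stack (flag arg), the environment spells out an arbitrary
-- term flag by flag (suc, var, lam, appfun, app) and finally plugs it in as
-- the argument (done). A machine bisimulation therefore has to answer every
-- such reading step, which forces it to relate the two closures applied to
-- every closed argument: exactly the clause of applicative bisimulation.
-- Conversely, an applicative bisimulation R induces a machine bisimulation
-- that relates ev-configurations by R and reading configurations with the
-- same partial term whenever the suspended closures are related by R on
-- every closed argument.
module Submission where

open import Defs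
open import Data.List using ([]; _∷_)
open import Data.List.Relation.Unary.All using (All; []; _∷_)
open import Data.Nat using (ℕ; zero; suc; _≤_; _⊔_; pred; z≤n; s≤s)
open import Data.Nat.Properties
  using (<-≤-trans; ≤-refl; m≤m⊔n; m≤n⊔m; ⊔-lub; pred-mono-≤; n≤0⇒n≡0)
open import Data.Product using (Σ-syntax; _×_; _,_)
open import Function.Bundles using (_⇔_; mk⇔)
open import Relation.Binary.Core using (Rel)
open import Relation.Unary using (Pred)
open import Relation.Binary.Definitions using (_Respects_)
open import Relation.Binary.PropositionalEquality using (_≡_; subst)
open import Relation.Binary.Construct.Closure.ReflexiveTransitive using (Star; ε; _◅_)

Star-respects : ∀ {a ℓ p} {A : Set a} {T : Rel A ℓ} {P : Pred A p} →
                P Respects T → P Respects Star T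
Star-respects resp ε        p = p
Star-respects resp (x ◅ xs) p = Star-respects resp xs (resp x p)

WS-weaken : ∀ {m m' t} → m ≤ m' → WS m t → WS m' t
WS-weaken m≤m' (var n<m) = var (<-≤-trans n<m m≤m')
WS-weaken m≤m' (app t s) = app (WS-weaken m≤m' t) (WS-weaken m≤m' s)
WS-weaken m≤m' (lam t)   = lam (WS-weaken (s≤s m≤m') t)

-- The least m with WS m t; it is the counter k that the machine computes
-- in tm t k while reading t.
scope : Tm → ℕ
scope (var n)   = suc n
scope (app t s) = scope s ⊔ scope t
scope (lam t)   = pred (scope t)

WS⇒scope≤ : ∀ {m t} → WS m t → scope t ≤ m
WS⇒scope≤ (var n<m) = n<m
WS⇒scope≤ (app t s) = ⊔-lub (WS⇒scope≤ s) (WS⇒scope≤ t)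
WS⇒scope≤ (lam t)   = pred-mono-≤ (WS⇒scope≤ t)

scope-closed : ∀ {t} → ClosedTm t → scope t ≡ 0
scope-closed t = n≤0⇒n≡0 (WS⇒scope≤ t)

WSAppStack : AppStack → Set
WSAppStack = All (λ { (t , k) → WS k t })

data IsEv : Conf → Set where
  is-ev : ∀ {t e π} → IsEv (ev t e π)

IsEv-respects-⟶τ* : IsEv Respects _⟶τ*_
IsEv-respects-⟶τ* = Star-respects λ where
  ev-app  _ → is-ev
  ev-zero _ → is-ev
  ev-suc  _ → is-ev
  ev-lam  _ → is-ev

data ClosedEv : Conf → Set where
  ev : ∀ {t e π} → ClosedClo (clo t e) → All ClosedClo π → ClosedEv (ev t e π)

ClosedEv-respects-⟶τ* : ClosedEv Respects _⟶τ*_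
ClosedEv-respects-⟶τ* = Star-respects λ where
  ev-app  (ev (clo (app t s) e) π)     → ev (clo t e) (clo s e ∷ π)
  ev-zero (ev (clo _ (σ ∷ _)) π)       → ev σ π
  ev-suc  (ev (clo (var (s≤s n<m)) (_ ∷ d)) π) → ev (clo (var n<m) d) π
  ev-lam  (ev (clo (lam t) e) (σ ∷ π)) → ev (clo t (σ ∷ e)) π

closed-body : ∀ {t e t' e' u} → ClosedClo (clo t e) → ev t e [] ⟶τ* ev (lam t') e' [] →
              ClosedTm u → ClosedClo (clo t' (clo u [] ∷ e'))
closed-body te-closed τs u with ClosedEv-respects-⟶τ* τs (ev te-closed [])
... | ev (clo (lam t') e') _ = clo t' (clo u [] ∷ e')

data LamReached (C : Conf) : Flag → Conf → Set where
  lam-reached : ∀ {t e} → C ⟶τ* ev (lam t) e [] → LamReached C arg (ind 0 [] (clo t e))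

ev-⟹-view : ∀ {C F C'} → IsEv C → C ⟹[ F ] C' → LamReached C F C'
ev-⟹-view isEv (_ , τs , step) = view (IsEv-respects-⟶τ* τs isEv) τs step
  where
  view : ∀ {C C₀ F C'} → IsEv C₀ → C ⟶τ* C₀ → C₀ ⟶[ fl F ] C' → LamReached C F C'
  view is-ev τs ev-arg = lam-reached τs

ForAllArgs : (Clo → Clo → Set) → Clo → Clo → Set
ForAllArgs R (clo t e) (clo s d) =
  ∀ u → ClosedTm u → R (clo t (clo u [] ∷ e)) (clo s (clo u [] ∷ d))

module FromAppBisim {R : Clo → Clo → Set} (B : AppBisim R) where
  open AppBisim B

  -- WS k t makes the term read so far closed when done fires with k = 0.
  data Induced : Conf → Conf → Set where
    ev  : ∀ {t e s d} → R (clo t e) (clo s d) → Induced (ev t e []) (ev s d [])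
    ind : ∀ {n ρ σ₁ σ₂} → WSAppStack ρ → ForAllArgs R σ₁ σ₂ →
          Induced (ind n ρ σ₁) (ind n ρ σ₂)
    tm  : ∀ {t k ρ σ₁ σ₂} → WS k t → WSAppStack ρ → ForAllArgs R σ₁ σ₂ →
          Induced (tm t k ρ σ₁) (tm t k ρ σ₂)

  ForAllArgs-sym : ∀ {σ₁ σ₂} → ForAllArgs R σ₁ σ₂ → ForAllArgs R σ₂ σ₁
  ForAllArgs-sym {clo _ _} {clo _ _} r u u-closed = sym (r u u-closed)

  Induced-sym : ∀ {C₁ C₂} → Induced C₁ C₂ → Induced C₂ C₁
  Induced-sym (ev r)       = ev (sym r)
  Induced-sym (ind ρ r)    = ind ρ (ForAllArgs-sym r)
  Induced-sym (tm t ρ r)   = tm t ρ (ForAllArgs-sym r)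

  Induced-step : ∀ {C₁ C₂ F C₁'} → Induced C₁ C₂ → C₁ ⟹[ F ] C₁' →
                 Σ[ C₂' ∈ Conf ] (C₂ ⟹[ F ] C₂' × Induced C₁' C₂')
  Induced-step (ev r) w with ev-⟹-view is-ev w
  ... | lam-reached τs with step r τs
  ...   | _ , _ , τs' , r' = _ , (_ , τs' , ev-arg) , ind [] r'
  Induced-step (ind ρ r) (_ , ε , ind-suc) = _ , (_ , ε , ind-suc) , ind ρ r
  Induced-step (ind ρ r) (_ , ε , ind-var) = _ , (_ , ε , ind-var) , tm (var ≤-refl) ρ r
  Induced-step (tm t ρ r) (_ , ε , tm-lam-suc) =
    _ , (_ , ε , tm-lam-suc) , tm (lam t) ρ r
  Induced-step (tm t ρ r) (_ , ε , tm-lam-zero) =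
    _ , (_ , ε , tm-lam-zero) , tm (lam (WS-weaken z≤n t)) ρ r
  Induced-step (tm t ρ r) (_ , ε , tm-appfun) =
    _ , (_ , ε , tm-appfun) , ind (t ∷ ρ) r
  Induced-step (tm {k = k₁} s (t ∷ ρ) r) (_ , ε , tm-app {k₂ = k₂}) =
    _ , (_ , ε , tm-app) ,
    tm (app (WS-weaken (m≤n⊔m k₁ k₂) t) (WS-weaken (m≤m⊔n k₁ k₂) s)) ρ r
  Induced-step (tm {t = u} {σ₁ = clo _ _} {σ₂ = clo _ _} u-closed [] r) (_ , ε , tm-done) =
    _ , (_ , ε , tm-done) , ev (r u u-closed)

  Induced-machineBisim : MachBisim Induced
  Induced-machineBisim = record
    { sym  = Induced-sym
    ; step = Induced-step
    ; term = λ { _ (_ , _ , ()) }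
    }

module FromMachBisim {R : Conf → Conf → Set} (B : MachBisim R) where
  open MachBisim B

  module Reading {σ₁ σ₂ : Clo} where
    Related : (Clo → Conf) → Set
    Related C = R (C σ₁) (C σ₂)

    read-suc : ∀ {n ρ} → Related (ind n ρ) → Related (ind (suc n) ρ)
    read-suc r with step r (_ , ε , ind-suc)
    ... | _ , (_ , ε , ind-suc) , r' = r'

    read-var : ∀ {n ρ} → Related (ind n ρ) → Related (tm (var n) (suc n) ρ)
    read-var r with step r (_ , ε , ind-var)
    ... | _ , (_ , ε , ind-var) , r' = r'

    read-lam : ∀ {t k ρ} → Related (tm t k ρ) → Related (tm (lam t) (pred k) ρ)
    read-lam {k = zero} r with step r (_ , ε , tm-lam-zero)
    ... | _ , (_ , ε , tm-lam-zero) , r' = r'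
    read-lam {k = suc k} r with step r (_ , ε , tm-lam-suc)
    ... | _ , (_ , ε , tm-lam-suc) , r' = r'

    read-appfun : ∀ {t k ρ} → Related (tm t k ρ) → Related (ind 0 ((t , k) ∷ ρ))
    read-appfun r with step r (_ , ε , tm-appfun)
    ... | _ , (_ , ε , tm-appfun) , r' = r'

    read-app : ∀ {s k₁ t k₂ ρ} → Related (tm s k₁ ((t , k₂) ∷ ρ)) →
               Related (tm (app t s) (k₁ ⊔ k₂) ρ)
    read-app r with step r (_ , ε , tm-app)
    ... | _ , (_ , ε , tm-app) , r' = r'

    read-index : ∀ n {ρ} → Related (ind 0 ρ) → Related (ind n ρ)
    read-index zero    r = r
    read-index (suc n) r = read-suc (read-index n r)

    read-term : ∀ t {ρ} → Related (ind 0 ρ) → Related (tm t (scope t) ρ)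
    read-term (var n)   r = read-var (read-index n r)
    read-term (app t s) r = read-app (read-term s (read-appfun (read-term t r)))
    read-term (lam t)   r = read-lam (read-term t r)

  open Reading

  read-done : ∀ {u t e s d} → R (tm u 0 [] (clo t e)) (tm u 0 [] (clo s d)) →
              R (ev t (clo u [] ∷ e) []) (ev s (clo u [] ∷ d) [])
  read-done r with step r (_ , ε , tm-done)
  ... | _ , (_ , ε , tm-done) , r' = r'

  load : Clo → Conf
  load (clo t e) = ev t e []

  after-arg : ∀ {σ₁ σ₂} → R (ind 0 [] σ₁) (ind 0 [] σ₂) →
              ForAllArgs (λ x y → R (load x) (load y)) σ₁ σ₂
  after-arg {clo _ _} {clo _ _} r u u-closed =
    read-done (subst (λ k → Related (tm u k [])) (scope-closed u-closed) (read-term u r))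

  Restricted : Clo → Clo → Set
  Restricted x y = ClosedClo x × ClosedClo y × R (load x) (load y)

  Restricted-step : ∀ {t e s d t' e'} → Restricted (clo t e) (clo s d) →
    ev t e [] ⟶τ* ev (lam t') e' [] →
    Σ[ s' ∈ Tm ] Σ[ d' ∈ Env ]
      (ev s d [] ⟶τ* ev (lam s') d' [] × ForAllArgs Restricted (clo t' e') (clo s' d'))
  Restricted-step (x-closed , y-closed , r) τs with step r (_ , τs , ev-arg)
  ... | _ , w , r' with ev-⟹-view is-ev w
  ...   | lam-reached τs' = _ , _ , τs' , λ u u-closed →
    closed-body x-closed τs u-closed , closed-body y-closed τs' u-closed , after-arg r' u u-closed

  Restricted-appBisim : AppBisim Restricted
  Restricted-appBisim = record
    { closed = λ (x-closed , y-closed , _) → x-closed , y-closed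
    ; sym    = λ (x-closed , y-closed , r) → y-closed , x-closed , sym r
    ; step   = Restricted-step
    }

theorem5p6 : ∀ t e s d → ClosedClo (clo t e) → ClosedClo (clo s d) →
    (clo t e ≈app clo s d) ⇔ (ev t e [] ≈m ev s d [])
theorem5p6 t e s d t-closed s-closed = mk⇔
  (λ (_ , B , r) → FromAppBisim.Induced B , FromAppBisim.Induced-machineBisim B , FromAppBisim.ev r)
  (λ (_ , B , r) → FromMachBisim.Restricted B , FromMachBisim.Restricted-appBisim B ,
                   (t-closed , s-closed , r))
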